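{- The number of strongly-connected word-graphs among the word-graphs represented by $\ell$-words over an $n$-alphabet is $\varphi(\ell,n) = n!\,T(\ell,n)$, where $$T(\ell, n) = \left\{ \ell-1 \atop n \right\} + \sum_{j=0}^{\ell-2} \sum_{m=0}^{n-2} \left\{ j \atop m \right\} T(\ell-j-1, n-m)\,(n-m-1),$$ with base cases $T(\ell,n)=0$ for $\ell\le 0$ or $\ell\le n$, and $T(\ell,1)=1$. Here $\left\{ a \atop b \right\}$ denotes the Stirling number of the second kind (the number of partitions of an $a$-set into $b$ nonempty subsets).
   Context: An $\ell$-word $\omega=\omega_1\ldots\omega_\ell$ over an $n$-alphabet uses exactly $n$ distinct letters, with $\ell>n>0$. The word-graph $G_\omega$ is the simple digraph with vertex set the alphabet of $\omega$ and directed edge set $\{(\omega_i,\omega_{i+1}) : 1\le i<\ell,\ \omega_i\neq\omega_{i+1}\}$. The family of word-graphs considered consists of the $G_\omega$ for all $\ell$-words $\omega$ over an $n$-alphabet (there are $n!\left\{ \ell \atop n \right\}$ such words, counted with multiplicity one per word). A digraph is strongly-connected if there is a directed path from every vertex to every other vertex. -}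

module Defs where

open import Data.Nat using (ℕ; zero; suc; _+_; _*_; _∸_; _≤?_)
open import Data.List using (List; map; upTo)
open import Data.Nat.ListAction using (sum)
open import Data.Fin using (Fin; toℕ)
open import Data.Vec using (Vec; lookup)
open import Data.Product using (∃; _×_)
open import Relation.Binary.PropositionalEquality using (_≡_; _≢_)
open import Relation.Binary.Construct.Closure.ReflexiveTransitive using (Star)
open import Relation.Nullary using (yes; no)

S : ℕ → ℕ → ℕ
S zero    zero    = 1
S zero    (suc b) = 0
S (suc a) zero    = 0
S (suc a) (suc b) = suc b * S a (suc b) + S a b

sumBelow : ℕ → (ℕ → ℕ) → ℕ
sumBelow k f = sum (map f (upTo k))

-- T with fuel; fuel ≥ ℓ suffices since recursive calls have first
-- argument ℓ - j - 1 < ℓ.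
Tf : ℕ → ℕ → ℕ → ℕ
Tf zero ℓ n = 0
Tf (suc fuel) ℓ n with ℓ ≤? n
... | yes _ = 0                      -- ℓ ≤ n (includes ℓ ≤ 0)
... | no _ with n
...   | 1 = 1
...   | _ = S (ℓ ∸ 1) n
              + sumBelow (ℓ ∸ 1) (λ j →
                  sumBelow (n ∸ 1) (λ m →
                    S j m * Tf fuel (ℓ ∸ j ∸ 1) (n ∸ m) * (n ∸ m ∸ 1)))

T : ℕ → ℕ → ℕ
T ℓ n = Tf ℓ ℓ n

Word : ℕ → ℕ → Set
Word ℓ n = Vec (Fin n) ℓ

UsesAll : ∀ {ℓ n} → Word ℓ n → Set
UsesAll {ℓ} {n} ω = (a : Fin n) → ∃ λ (i : Fin ℓ) → lookup ω i ≡ a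

Edge : ∀ {ℓ n} → Word ℓ n → Fin n → Fin n → Set
Edge {ℓ} ω u v = ∃ λ (i : Fin ℓ) → ∃ λ (j : Fin ℓ) →
  toℕ j ≡ suc (toℕ i) × lookup ω i ≡ u × lookup ω j ≡ v × u ≢ v

StronglyConnected : ∀ {ℓ n} → Word ℓ n → Set
StronglyConnected {n = n} ω = (u v : Fin n) → Star (Edge ω) u v

-- Read ω from right to left and, after each letter, label every letter of the alphabet
-- `reached` if it is reachable from the last letter of ω in the word-graph of the suffix
-- read so far, `pending` if it occurs in that suffix but is not reached, and `unseen`
-- otherwise. Prepending a letter x updates the labels locally: if x is reached, then x
-- reaches the old first letter and through it every letter of the suffix, so all pending
-- letters become reached; if x is pending nothing changes; if x is unseen it becomes
-- pending. G_ω is strongly connected and uses all n letters iff every letter ends up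
-- reached, i.e. iff the statistics (seen letters, pending letters) end at (n, 0).
-- These statistics evolve by a linear recurrence, solved by n P t · E(p, t, c) with
-- numbers E independent of n. Summing E over c gives Stirling numbers, and cutting a word
-- at the last moment at which no letter was pending gives
-- E(p, b + m, m) = Σ_j E(p − j, b, 0) S(j, m); these two identities turn the recurrence
-- for E(ℓ − 1, n, 0) into the recurrence defining T(ℓ, n).

module Submission where

open import Defs
open import Data.Nat
open import Data.Nat.Properties
open import Algebra.Properties.CommutativeSemigroup +-commutativeSemigroup using (interchange)
open import Algebra.Properties.Semiring.Sum +-*-semiring
  using (sum-syntax; sum-cong-≗; ∑-distrib-+; *-distribʳ-sum; sum-replicate-zero)
open import Data.Bool using (if_then_else_)
open import Data.Bool.Properties using (T-≡)
open import Data.Empty using (⊥-elim)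
open import Data.Fin using (Fin; zero; suc) renaming (_≟_ to _≟ᶠ_)
open import Data.List using (List; []; _∷_; _++_; map; applyUpTo; tabulate; cartesianProductWith; allFin; length; filter)
open import Data.List.Membership.Propositional using (_∈_)
open import Data.List.Membership.Propositional.Properties using (∈-cartesianProductWith⁺; ∈-allFin; ∈-filter⁺; ∈-filter⁻)
open import Data.List.Properties using (map-++)
open import Data.List.Relation.Unary.All using ([])
open import Data.List.Relation.Unary.AllPairs using ([]; _∷_)
open import Data.List.Relation.Unary.Any using (here)
open import Data.List.Relation.Unary.Unique.Propositional using (Unique)
import Data.List.Relation.Unary.Unique.Propositional.Properties as Unique
open import Data.Nat.Combinatorics using (nPn≡n!)
open import Data.Nat.Combinatorics.Base using (_P′_)
open import Data.Nat.ListAction using (sum)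
open import Data.Nat.ListAction.Properties using (sum-++)
open import Data.Nat.Tactic.RingSolver using (solve-∀)
open import Data.Product using (∃; _×_; _,_; proj₂)
open import Data.Sum using (_⊎_; inj₁; inj₂)
open import Data.Vec using ([]; _∷_; head; lookup)
open import Data.Vec.Functional using (updateAt)
open import Data.Vec.Functional.Properties using (updateAt-updates; updateAt-minimal)
open import Data.Vec.Properties using (∷-injective)
open import Function using (_∘_; id)
open import Function.Bundles using (_⇔_; mk⇔; Equivalence)
open import Function.Construct.Composition using (_⇔-∘_)
open import Relation.Binary.Construct.Closure.ReflexiveTransitive using (Star; ε; _◅_; _◅◅_)
open import Relation.Binary.PropositionalEquality
open import Relation.Nullary using (yes; no; ¬_)

private variable
  A B C : Set

∑ℕ : ℕ → (ℕ → ℕ) → ℕ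
∑ℕ zero    f = 0
∑ℕ (suc k) f = f 0 + ∑ℕ k (f ∘ suc)

∑ℕ-cong : ∀ k {f g : ℕ → ℕ} → (∀ i → i < k → f i ≡ g i) → ∑ℕ k f ≡ ∑ℕ k g
∑ℕ-cong zero    f≡g = refl
∑ℕ-cong (suc k) f≡g = cong₂ _+_ (f≡g 0 z<s) (∑ℕ-cong k (λ i i<k → f≡g (suc i) (s<s i<k)))

∑ℕ-zero : ∀ k {f : ℕ → ℕ} → (∀ i → i < k → f i ≡ 0) → ∑ℕ k f ≡ 0
∑ℕ-zero zero    f≡0 = refl
∑ℕ-zero (suc k) f≡0 rewrite f≡0 0 z<s = ∑ℕ-zero k (λ i i<k → f≡0 (suc i) (s<s i<k))

∑ℕ-suc : ∀ k (f : ℕ → ℕ) → ∑ℕ (suc k) f ≡ ∑ℕ k f + f k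
∑ℕ-suc zero    f = +-comm (f 0) 0
∑ℕ-suc (suc k) f = trans (cong (f 0 +_) (∑ℕ-suc k (f ∘ suc))) (sym (+-assoc (f 0) _ _))

∑ℕ-distrib-+ : ∀ k (f g : ℕ → ℕ) → ∑ℕ k (λ i → f i + g i) ≡ ∑ℕ k f + ∑ℕ k g
∑ℕ-distrib-+ zero    f g = refl
∑ℕ-distrib-+ (suc k) f g =
  trans (cong (f 0 + g 0 +_) (∑ℕ-distrib-+ k (f ∘ suc) (g ∘ suc))) (interchange (f 0) (g 0) _ _)

∑ℕ-*ʳ : ∀ k (f : ℕ → ℕ) a → ∑ℕ k (λ i → f i * a) ≡ ∑ℕ k f * a
∑ℕ-*ʳ zero    f a = refl
∑ℕ-*ʳ (suc k) f a = trans (cong (f 0 * a +_) (∑ℕ-*ʳ k (f ∘ suc) a)) (sym (*-distribʳ-+ a (f 0) _))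

∑ℕ-*ˡ : ∀ k (f : ℕ → ℕ) a → ∑ℕ k (λ i → a * f i) ≡ a * ∑ℕ k f
∑ℕ-*ˡ k f a = trans (∑ℕ-cong k (λ i _ → *-comm a (f i))) (trans (∑ℕ-*ʳ k f a) (*-comm (∑ℕ k f) a))

∑ℕ-comm : ∀ j k (f : ℕ → ℕ → ℕ) → ∑ℕ j (λ a → ∑ℕ k (f a)) ≡ ∑ℕ k (λ b → ∑ℕ j (λ a → f a b))
∑ℕ-comm zero    k f = sym (∑ℕ-zero k (λ _ _ → refl))
∑ℕ-comm (suc j) k f =
  trans (cong (∑ℕ k (f 0) +_) (∑ℕ-comm j k (f ∘ suc))) (sym (∑ℕ-distrib-+ k (f 0) _))

sum-applyUpTo : ∀ k (f g : ℕ → ℕ) → sum (map f (applyUpTo g k)) ≡ ∑ℕ k (f ∘ g)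
sum-applyUpTo zero    f g = refl
sum-applyUpTo (suc k) f g = cong (f (g 0) +_) (sum-applyUpTo k f (g ∘ suc))

sumBelow≡∑ℕ : ∀ k f → sumBelow k f ≡ ∑ℕ k f
sumBelow≡∑ℕ k f = sum-applyUpTo k f id

∑ℕ-weight-shift : ∀ k (f : ℕ → ℕ) → f (suc k) ≡ 0 →
  ∑ℕ (suc (suc k)) f + ∑ℕ k (λ m → f m * (suc k ∸ m ∸ 1)) ≡ ∑ℕ (suc (suc k)) (λ c → f c * (suc k ∸ c))
∑ℕ-weight-shift k f f[k+1]≡0 = begin
  ∑ℕ (suc (suc k)) f + ∑ℕ k g
    ≡⟨ cong (∑ℕ (suc (suc k)) f +_) extend ⟩
  ∑ℕ (suc (suc k)) f + ∑ℕ (suc (suc k)) g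
    ≡⟨ sym (∑ℕ-distrib-+ (suc (suc k)) f g) ⟩
  ∑ℕ (suc (suc k)) (λ c → f c + g c)
    ≡⟨ ∑ℕ-cong (suc (suc k)) (λ c c<k+2 → weight c (≤-pred c<k+2)) ⟩
  ∑ℕ (suc (suc k)) (λ c → f c * (suc k ∸ c))
    ∎
  where
  open ≡-Reasoning
  g : ℕ → ℕ
  g m = f m * (suc k ∸ m ∸ 1)
  extend : ∑ℕ k g ≡ ∑ℕ (suc (suc k)) g
  extend = sym (begin
    ∑ℕ (suc (suc k)) g        ≡⟨ ∑ℕ-suc (suc k) g ⟩
    ∑ℕ (suc k) g + g (suc k)  ≡⟨ cong₂ _+_ (∑ℕ-suc k g) (cong (λ x → f (suc k) * (x ∸ 1)) (n∸n≡0 k)) ⟩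
    ∑ℕ k g + g k + f (suc k) * 0 ≡⟨ cong₂ (λ x y → ∑ℕ k g + f k * (x ∸ 1) + y) (m+n∸n≡m 1 k) (*-zeroʳ (f (suc k))) ⟩
    ∑ℕ k g + f k * 0 + 0      ≡⟨ trans (+-identityʳ _) (trans (cong (∑ℕ k g +_) (*-zeroʳ (f k))) (+-identityʳ _)) ⟩
    ∑ℕ k g                    ∎)
  weight : ∀ c → c ≤ suc k → f c + g c ≡ f c * (suc k ∸ c)
  weight c c≤k+1 with m≤n⇒m<n∨m≡n c≤k+1
  ... | inj₁ (s≤s c≤k) rewrite +-∸-assoc 1 c≤k = sym (*-suc (f c) (k ∸ c))
  ... | inj₂ refl rewrite f[k+1]≡0 = refl

∑-const : ∀ n k → ∑[ i < n ] k ≡ n * k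
∑-const zero    k = refl
∑-const (suc n) k = cong (k +_) (∑-const n k)

∑-updateAt : ∀ {n} (s : Fin n → A) x (h : A → A) (f : A → ℕ) →
  ∑[ y < n ] f (updateAt s x h y) + f (s x) ≡ ∑[ y < n ] f (s y) + f (h (s x))
∑-updateAt {n = suc n} s zero    h f = begin
  f (h (s zero)) + ∑[ y < n ] f (s (suc y)) + f (s zero)   ≡⟨ +-assoc (f (h (s zero))) _ _ ⟩
  f (h (s zero)) + (∑[ y < n ] f (s (suc y)) + f (s zero)) ≡⟨ +-comm (f (h (s zero))) _ ⟩
  ∑[ y < n ] f (s (suc y)) + f (s zero) + f (h (s zero))   ≡⟨ cong (_+ f (h (s zero))) (+-comm _ (f (s zero))) ⟩
  f (s zero) + ∑[ y < n ] f (s (suc y)) + f (h (s zero))   ∎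
  where open ≡-Reasoning
∑-updateAt {n = suc n} s (suc x) h f =
  trans (+-assoc (f (s zero)) _ _) (trans (cong (f (s zero) +_) (∑-updateAt (s ∘ suc) x h f)) (sym (+-assoc (f (s zero)) _ _)))

∑-≤1 : ∀ {n} (f : Fin n → ℕ) → (∀ y → f y ≤ 1) → ∑[ y < n ] f y ≤ n
∑-≤1 {zero}  f f≤1 = z≤n
∑-≤1 {suc n} f f≤1 = +-mono-≤ (f≤1 zero) (∑-≤1 (f ∘ suc) (f≤1 ∘ suc))

∑-≤1-full : ∀ {n} (f : Fin n → ℕ) → (∀ y → f y ≤ 1) → ∑[ y < n ] f y ≡ n → ∀ y → f y ≡ 1
∑-≤1-full {suc n} f f≤1 ∑f≡n y with m≤n⇒m<n∨m≡n (f≤1 zero)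
... | inj₁ (s≤s f0≤0) = ⊥-elim (1+n≰n (begin
  suc n                       ≡⟨ sym ∑f≡n ⟩
  f zero + ∑[ y < n ] f (suc y) ≡⟨ cong (_+ ∑[ y < n ] f (suc y)) (n≤0⇒n≡0 f0≤0) ⟩
  ∑[ y < n ] f (suc y)        ≤⟨ ∑-≤1 (f ∘ suc) (f≤1 ∘ suc) ⟩
  n                           ∎))
  where open ≤-Reasoning
... | inj₂ f0≡1 with y
...   | zero  = f0≡1
...   | suc y = ∑-≤1-full (f ∘ suc) (f≤1 ∘ suc) (suc-injective (trans (cong (_+ ∑[ y < n ] f (suc y)) (sym f0≡1)) ∑f≡n)) y

∑ˡ : List A → (A → ℕ) → ℕ
∑ˡ xs f = sum (map f xs)

∑ˡ-cong : ∀ (xs : List A) {f g : A → ℕ} → (∀ x → f x ≡ g x) → ∑ˡ xs f ≡ ∑ˡ xs g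
∑ˡ-cong []       f≡g = refl
∑ˡ-cong (x ∷ xs) f≡g = cong₂ _+_ (f≡g x) (∑ˡ-cong xs f≡g)

∑ˡ-distrib-+ : ∀ (xs : List A) (f g : A → ℕ) → ∑ˡ xs (λ x → f x + g x) ≡ ∑ˡ xs f + ∑ˡ xs g
∑ˡ-distrib-+ []       f g = refl
∑ˡ-distrib-+ (x ∷ xs) f g = trans (cong (f x + g x +_) (∑ˡ-distrib-+ xs f g)) (interchange (f x) (g x) _ _)

∑ˡ-*ʳ : ∀ (xs : List A) (f : A → ℕ) a → ∑ˡ xs (λ x → f x * a) ≡ ∑ˡ xs f * a
∑ˡ-*ʳ []       f a = refl
∑ˡ-*ʳ (x ∷ xs) f a = trans (cong (f x * a +_) (∑ˡ-*ʳ xs f a)) (sym (*-distribʳ-+ a (f x) _))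

∑ˡ-++ : ∀ (xs ys : List A) (f : A → ℕ) → ∑ˡ (xs ++ ys) f ≡ ∑ˡ xs f + ∑ˡ ys f
∑ˡ-++ xs ys f = trans (cong sum (map-++ f xs ys)) (sum-++ (map f xs) (map f ys))

∑ˡ-map : ∀ (g : A → B) (xs : List A) (f : B → ℕ) → ∑ˡ (map g xs) f ≡ ∑ˡ xs (f ∘ g)
∑ˡ-map g []       f = refl
∑ˡ-map g (x ∷ xs) f = cong (f (g x) +_) (∑ˡ-map g xs f)

∑ˡ-cartesianProductWith : ∀ (h : A → B → C) xs ys (f : C → ℕ) →
  ∑ˡ (cartesianProductWith h xs ys) f ≡ ∑ˡ xs (λ x → ∑ˡ ys (λ y → f (h x y)))
∑ˡ-cartesianProductWith h []       ys f = refl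
∑ˡ-cartesianProductWith h (x ∷ xs) ys f = begin
  ∑ˡ (map (h x) ys ++ cartesianProductWith h xs ys) f          ≡⟨ ∑ˡ-++ (map (h x) ys) _ f ⟩
  ∑ˡ (map (h x) ys) f + ∑ˡ (cartesianProductWith h xs ys) f    ≡⟨ cong₂ _+_ (∑ˡ-map (h x) ys f) (∑ˡ-cartesianProductWith h xs ys f) ⟩
  ∑ˡ ys (f ∘ h x) + ∑ˡ xs (λ x → ∑ˡ ys (λ y → f (h x y)))      ∎
  where open ≡-Reasoning

∑ˡ-tabulate : ∀ {k} (g : Fin k → A) (f : A → ℕ) → ∑ˡ (tabulate g) f ≡ ∑[ i < k ] f (g i)
∑ˡ-tabulate {k = zero}  g f = refl
∑ˡ-tabulate {k = suc k} g f = cong (f (g zero) +_) (∑ˡ-tabulate (g ∘ suc) f)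

∑ˡ-zero : ∀ (xs : List A) → ∑ˡ xs (λ _ → 0) ≡ 0
∑ˡ-zero []       = refl
∑ˡ-zero (x ∷ xs) = ∑ˡ-zero xs

∑ˡ-∑ℕ-comm : ∀ (xs : List A) k (f : ℕ → A → ℕ) → ∑ˡ xs (λ x → ∑ℕ k (λ i → f i x)) ≡ ∑ℕ k (λ i → ∑ˡ xs (f i))
∑ˡ-∑ℕ-comm []       k f = sym (∑ℕ-zero k (λ _ _ → refl))
∑ˡ-∑ℕ-comm (x ∷ xs) k f = trans (cong (∑ℕ k (λ i → f i x) +_) (∑ˡ-∑ℕ-comm xs k f)) (sym (∑ℕ-distrib-+ k (λ i → f i x) _))

∑ˡ-∑-comm : ∀ (xs : List A) {k} (f : Fin k → A → ℕ) →
  ∑ˡ xs (λ x → ∑[ i < k ] f i x) ≡ ∑[ i < k ] ∑ˡ xs (f i)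
∑ˡ-∑-comm []       {k} f = sym (sum-replicate-zero k)
∑ˡ-∑-comm (x ∷ xs) f = trans (cong (∑[ i < _ ] f i x +_) (∑ˡ-∑-comm xs f)) (sym (∑-distrib-+ (λ i → f i x) _))

length-filter-indicator : ∀ (xs : List A) (f : A → ℕ) → (∀ x → f x ≤ 1) →
  length (filter (λ x → f x ≟ 1) xs) ≡ ∑ˡ xs f
length-filter-indicator []       f f≤1 = refl
length-filter-indicator (x ∷ xs) f f≤1 with f x ≟ 1
... | yes fx≡1 rewrite fx≡1 = cong suc (length-filter-indicator xs f f≤1)
... | no fx≢1 with m≤n⇒m<n∨m≡n (f≤1 x)
...   | inj₁ (s≤s fx≤0) rewrite n≤0⇒n≡0 fx≤0 = length-filter-indicator xs f f≤1
...   | inj₂ fx≡1 = ⊥-elim (fx≢1 fx≡1)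

δ : ℕ → ℕ → ℕ
δ zero    zero    = 1
δ zero    (suc b) = 0
δ (suc a) zero    = 0
δ (suc a) (suc b) = δ a b

δ-refl : ∀ a → δ a a ≡ 1
δ-refl zero    = refl
δ-refl (suc a) = δ-refl a

δ-≢ : ∀ {a b} → a ≢ b → δ a b ≡ 0
δ-≢ {zero}  {zero}  a≢b = ⊥-elim (a≢b refl)
δ-≢ {zero}  {suc b} a≢b = refl
δ-≢ {suc a} {zero}  a≢b = refl
δ-≢ {suc a} {suc b} a≢b = δ-≢ (a≢b ∘ cong suc)

δ≡1⇒≡ : ∀ {a b} → δ a b ≡ 1 → a ≡ b
δ≡1⇒≡ {zero}  {zero}  _ = refl
δ≡1⇒≡ {suc a} {suc b} e = cong suc (δ≡1⇒≡ e)

δ≤1 : ∀ a b → δ a b ≤ 1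
δ≤1 zero    zero    = ≤-refl
δ≤1 zero    (suc b) = z≤n
δ≤1 (suc a) zero    = z≤n
δ≤1 (suc a) (suc b) = δ≤1 a b

δ-subst : ∀ a b (h : ℕ → ℕ) → δ a b * h a ≡ δ a b * h b
δ-subst a b h with a ≟ b
... | yes refl = refl
... | no a≢b rewrite δ-≢ a≢b = refl

∑ℕ-δ : ∀ k a (h : ℕ → ℕ) → a < k → ∑ℕ k (λ c → δ a c * h c) ≡ h a
∑ℕ-δ (suc k) zero    h _ = trans (cong₂ _+_ (+-identityʳ (h 0)) (∑ℕ-zero k (λ _ _ → refl))) (+-identityʳ (h 0))
∑ℕ-δ (suc k) (suc a) h (s≤s a<k) = ∑ℕ-δ k a (h ∘ suc) a<k

-- The numbers E and the recurrence for T

-- E p t c counts the words of length p + 1 using exactly t letters, named in order of first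
-- occurrence from the right, whose scan ends with c pending letters.
E : ℕ → ℕ → ℕ → ℕ
E zero    1       zero    = 1
E zero    _       _       = 0
E (suc p) t       zero    = ∑ℕ (suc t) λ c → E p t c * (t ∸ c)
E (suc p) zero    (suc c) = 0
E (suc p) (suc t) (suc c) = E p (suc t) (suc c) * suc c + E p t c

E-no-letters : ∀ p c → E p 0 c ≡ 0
E-no-letters zero    c       = refl
E-no-letters (suc p) zero    rewrite E-no-letters p 0 = refl
E-no-letters (suc p) (suc c) = refl

E-singleton-pending : ∀ t c → E 0 t (suc c) ≡ 0
E-singleton-pending zero          c = refl
E-singleton-pending (suc zero)    c = refl
E-singleton-pending (suc (suc t)) c = refl

E-all-pending : ∀ p t → E p t t ≡ 0
E-all-pending p       zero    = E-no-letters p 0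
E-all-pending zero    (suc t) = E-singleton-pending (suc t) t
E-all-pending (suc p) (suc t) rewrite E-all-pending p (suc t) | E-all-pending p t = refl

E-one-letter : ∀ p → E p 1 0 ≡ 1
E-one-letter zero    = refl
E-one-letter (suc p) rewrite E-one-letter p | *-zeroʳ (E p 1 1) = refl

E-too-many-letters : ∀ p t c → suc p < t → E p t c ≡ 0
E-too-many-letters zero    (suc (suc t)) c       _ = refl
E-too-many-letters zero    (suc zero)    c       (s≤s ())
E-too-many-letters (suc p) t             zero    p<t =
  ∑ℕ-zero (suc t) (λ c _ → cong (_* (t ∸ c)) (E-too-many-letters p t c (<-trans (n<1+n _) p<t)))
E-too-many-letters (suc p) (suc t)       (suc c) (s≤s p<t)
  rewrite E-too-many-letters p (suc t) (suc c) (<-trans (n<1+n _) (s≤s p<t)) | E-too-many-letters p t c p<t = refl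

∑ℕ-E≡S : ∀ p t → ∑ℕ (suc t) (E p t) ≡ S (suc p) t
∑ℕ-E≡S zero    zero          = refl
∑ℕ-E≡S zero    (suc zero)    = refl
∑ℕ-E≡S zero    (suc (suc t)) =
  trans (∑ℕ-zero (suc (suc (suc t))) {E 0 (suc (suc t))} λ { zero _ → refl ; (suc c) _ → refl })
        (sym (trans (+-identityʳ _) (*-zeroʳ (suc (suc t)))))
∑ℕ-E≡S (suc p) zero          rewrite E-no-letters p 0 = refl
∑ℕ-E≡S (suc p) (suc t)       = begin
  E (suc p) t′ 0 + ∑ℕ t′ (λ c → E p t′ (suc c) * suc c + E p t c)
    ≡⟨ cong (E (suc p) t′ 0 +_) (∑ℕ-distrib-+ t′ (λ c → E p t′ (suc c) * suc c) (E p t)) ⟩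
  E (suc p) t′ 0 + (∑ℕ t′ (λ c → E p t′ (suc c) * suc c) + ∑ℕ t′ (E p t))
    ≡⟨ sym (+-assoc (E (suc p) t′ 0) _ _) ⟩
  E (suc p) t′ 0 + ∑ℕ t′ (λ c → E p t′ (suc c) * suc c) + ∑ℕ t′ (E p t)
    ≡⟨ cong (λ z → E (suc p) t′ 0 + (z + ∑ℕ t′ (λ c → E p t′ (suc c) * suc c)) + ∑ℕ t′ (E p t)) (sym (*-zeroʳ (E p t′ 0))) ⟩
  ∑ℕ (suc t′) (λ c → E p t′ c * (t′ ∸ c)) + ∑ℕ (suc t′) (λ c → E p t′ c * c) + ∑ℕ t′ (E p t)
    ≡⟨ cong₂ _+_ weights (∑ℕ-E≡S p t) ⟩
  t′ * S (suc p) t′ + S (suc p) t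
    ∎
  where
  open ≡-Reasoning
  t′ = suc t
  weights : ∑ℕ (suc t′) (λ c → E p t′ c * (t′ ∸ c)) + ∑ℕ (suc t′) (λ c → E p t′ c * c) ≡ t′ * S (suc p) t′
  weights = begin
    ∑ℕ (suc t′) (λ c → E p t′ c * (t′ ∸ c)) + ∑ℕ (suc t′) (λ c → E p t′ c * c)
      ≡⟨ sym (∑ℕ-distrib-+ (suc t′) (λ c → E p t′ c * (t′ ∸ c)) (λ c → E p t′ c * c)) ⟩
    ∑ℕ (suc t′) (λ c → E p t′ c * (t′ ∸ c) + E p t′ c * c)
      ≡⟨ ∑ℕ-cong (suc t′) (λ c c≤t′ →
           trans (sym (*-distribˡ-+ (E p t′ c) (t′ ∸ c) c)) (cong (E p t′ c *_) (m∸n+n≡m (≤-pred c≤t′)))) ⟩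
    ∑ℕ (suc t′) (λ c → E p t′ c * t′)
      ≡⟨ ∑ℕ-*ʳ (suc t′) (E p t′) t′ ⟩
    ∑ℕ (suc t′) (E p t′) * t′
      ≡⟨ cong (_* t′) (∑ℕ-E≡S p t′) ⟩
    S (suc p) t′ * t′
      ≡⟨ *-comm (S (suc p) t′) t′ ⟩
    t′ * S (suc p) t′
      ∎

-- The letters read after the last moment with no pending letter are exactly the m pending
-- ones, and the j positions read then are split among them in S j m ways.
E-split : ∀ p b m → E p (b + m) m ≡ ∑ℕ (suc p) (λ j → E (p ∸ j) b 0 * S j m)
E-split p       b zero    = begin
  E p (b + 0) 0                                  ≡⟨ cong (λ t → E p t 0) (+-identityʳ b) ⟩
  E p b 0                                        ≡⟨ sym (*-identityʳ (E p b 0)) ⟩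
  E p b 0 * 1                                    ≡⟨ sym (+-identityʳ _) ⟩
  E p b 0 * 1 + 0                                ≡⟨ cong (E p b 0 * 1 +_) (sym (∑ℕ-zero p (λ j _ → *-zeroʳ (E (p ∸ suc j) b 0)))) ⟩
  E p b 0 * 1 + ∑ℕ p (λ j → E (p ∸ suc j) b 0 * 0) ∎
  where open ≡-Reasoning
E-split zero    b (suc m) = begin
  E 0 (b + suc m) (suc m)    ≡⟨ E-singleton-pending (b + suc m) m ⟩
  0                          ≡⟨ sym (trans (+-identityʳ _) (*-zeroʳ (E 0 b 0))) ⟩
  E 0 b 0 * 0 + 0            ∎
  where open ≡-Reasoning
E-split (suc p) b (suc m) = begin
  E (suc p) (b + suc m) (suc m)
    ≡⟨ cong (λ t → E (suc p) t (suc m)) (+-suc b m) ⟩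
  E p (suc (b + m)) (suc m) * suc m + E p (b + m) m
    ≡⟨ cong₂ (λ x y → x * suc m + y) (trans (cong (λ t → E p t (suc m)) (sym (+-suc b m))) (E-split p b (suc m))) (E-split p b m) ⟩
  ∑ℕ (suc p) (λ j → e j * S j (suc m)) * suc m + ∑ℕ (suc p) (λ j → e j * S j m)
    ≡⟨ cong (_+ ∑ℕ (suc p) (λ j → e j * S j m)) (sym (∑ℕ-*ʳ (suc p) (λ j → e j * S j (suc m)) (suc m))) ⟩
  ∑ℕ (suc p) (λ j → e j * S j (suc m) * suc m) + ∑ℕ (suc p) (λ j → e j * S j m)
    ≡⟨ sym (∑ℕ-distrib-+ (suc p) (λ j → e j * S j (suc m) * suc m) (λ j → e j * S j m)) ⟩
  ∑ℕ (suc p) (λ j → e j * S j (suc m) * suc m + e j * S j m)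
    ≡⟨ ∑ℕ-cong (suc p) (λ j _ → stirling-step j) ⟩
  ∑ℕ (suc p) (λ j → e j * S (suc j) (suc m))
    ≡⟨ cong (_+ ∑ℕ (suc p) (λ j → e j * S (suc j) (suc m))) (sym (*-zeroʳ (E (suc p) b 0))) ⟩
  E (suc p) b 0 * 0 + ∑ℕ (suc p) (λ j → e j * S (suc j) (suc m))
    ∎
  where
  open ≡-Reasoning
  e : ℕ → ℕ
  e j = E (p ∸ j) b 0
  stirling-step : ∀ j → e j * S j (suc m) * suc m + e j * S j m ≡ e j * S (suc j) (suc m)
  stirling-step j = begin
    e j * S j (suc m) * suc m + e j * S j m      ≡⟨ cong (_+ e j * S j m) (*-assoc (e j) _ _) ⟩
    e j * (S j (suc m) * suc m) + e j * S j m    ≡⟨ sym (*-distribˡ-+ (e j) _ _) ⟩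
    e j * (S j (suc m) * suc m + S j m)          ≡⟨ cong (λ x → e j * (x + S j m)) (*-comm (S j (suc m)) (suc m)) ⟩
    e j * S (suc j) (suc m)                      ∎

E-short-word : ∀ p t → 2 ≤ t → suc p ≤ t → E p t 0 ≡ 0
E-short-word p       t       _   p<t with m≤n⇒m<n∨m≡n p<t
... | inj₁ p+1<t = E-too-many-letters p t 0 p+1<t
E-short-word (suc p) (suc t) _   _   | inj₂ refl =
  ∑ℕ-zero (suc (suc t)) (λ c _ → cong (_* (suc t ∸ c)) (E-too-many-letters p (suc t) c ≤-refl))
E-short-word zero    (suc t) (s≤s ()) _ | inj₂ refl

Tf≡E : ∀ fuel p k → 2 ≤ k → suc p ≤ fuel → Tf fuel (suc p) k ≡ E p k 0
Tf≡E (suc fuel) p k 2≤k _ with suc p ≤? k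
... | yes p<k = sym (E-short-word p k 2≤k p<k)
Tf≡E (suc fuel) p       (suc zero)    (s≤s ()) _ | no _
Tf≡E (suc fuel) zero    (suc (suc k)) _ _ | no p≮k = ⊥-elim (p≮k (s≤s z≤n))
Tf≡E (suc fuel) (suc p) (suc (suc k)) _ (s≤s p<fuel) | no _ = begin
  S (suc p) K + sumBelow (suc p) (λ j → sumBelow (suc k) (term j))
    ≡⟨ cong₂ _+_ (sym (∑ℕ-E≡S p K)) (trans (sumBelow≡∑ℕ (suc p) _) (∑ℕ-cong (suc p) λ j j<p+1 →
         trans (sumBelow≡∑ℕ (suc k) (term j)) (∑ℕ-cong (suc k) λ m m<k+1 → recursive-term j m (≤-pred j<p+1) m<k+1))) ⟩
  ∑ℕ (suc K) (E p K) + ∑ℕ (suc p) (λ j → ∑ℕ (suc k) (λ m → E (p ∸ j) (K ∸ m) 0 * S j m * (K ∸ m ∸ 1)))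
    ≡⟨ cong (∑ℕ (suc K) (E p K) +_) (∑ℕ-comm (suc p) (suc k) (λ j m → E (p ∸ j) (K ∸ m) 0 * S j m * (K ∸ m ∸ 1))) ⟩
  ∑ℕ (suc K) (E p K) + ∑ℕ (suc k) (λ m → ∑ℕ (suc p) (λ j → E (p ∸ j) (K ∸ m) 0 * S j m * (K ∸ m ∸ 1)))
    ≡⟨ cong (∑ℕ (suc K) (E p K) +_) (∑ℕ-cong (suc k) λ m m<k+1 →
         trans (∑ℕ-*ʳ (suc p) (λ j → E (p ∸ j) (K ∸ m) 0 * S j m) (K ∸ m ∸ 1))
               (cong (_* (K ∸ m ∸ 1)) (split m (≤-trans (<⇒≤ m<k+1) (n≤1+n (suc k)))))) ⟩
  ∑ℕ (suc K) (E p K) + ∑ℕ (suc k) (λ m → E p K m * (K ∸ m ∸ 1))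
    ≡⟨ ∑ℕ-weight-shift (suc k) (E p K) (E-all-pending p K) ⟩
  E (suc p) K 0
    ∎
  where
  open ≡-Reasoning
  K = suc (suc k)
  split : ∀ m → m ≤ K → ∑ℕ (suc p) (λ j → E (p ∸ j) (K ∸ m) 0 * S j m) ≡ E p K m
  split m m≤K = trans (sym (E-split p (K ∸ m) m)) (cong (λ t → E p t m) (m∸n+n≡m m≤K))
  term : ℕ → ℕ → ℕ
  term j m = S j m * Tf fuel (suc (suc p) ∸ j ∸ 1) (K ∸ m) * (K ∸ m ∸ 1)
  recursive-term : ∀ j m → j ≤ p → m < suc k → term j m ≡ E (p ∸ j) (K ∸ m) 0 * S j m * (K ∸ m ∸ 1)
  recursive-term j m j≤p m<k+1 rewrite +-∸-assoc 2 j≤p | +-∸-assoc 2 (≤-pred m<k+1) =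
    cong (_* suc (k ∸ m)) (trans (cong (S j m *_) (Tf≡E fuel (p ∸ j) (2 + (k ∸ m)) (s≤s (s≤s z≤n)) (≤-trans (s≤s (m∸n≤m p j)) p<fuel)))
                                 (*-comm (S j m) _))

T-one-letter : ∀ p → T (suc (suc p)) 1 ≡ 1
T-one-letter p with suc (suc p) ≤? 1
... | no _           = refl
... | yes (s≤s ())

E≡T : ∀ p n → 0 < n → n < suc p → E p n 0 ≡ T (suc p) n
E≡T zero    (suc zero)    _ (s≤s ())
E≡T (suc p) (suc zero)    _ _ = trans (E-one-letter (suc p)) (sym (T-one-letter p))
E≡T p       (suc (suc n)) _ _ = sym (Tf≡E (suc p) p (suc (suc n)) (s≤s (s≤s z≤n)) ≤-refl)

module _ {n : ℕ} where

  Occurs : ∀ {ℓ} → Word ℓ n → Fin n → Set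
  Occurs {ℓ} w a = ∃ λ (i : Fin ℓ) → lookup w i ≡ a

  lastLetter : ∀ {p} → Word (suc p) n → Fin n
  lastLetter (z ∷ [])    = z
  lastLetter (x ∷ y ∷ w) = lastLetter (y ∷ w)

  lastLetter-∷ : ∀ {p} x (w : Word (suc p) n) → lastLetter (x ∷ w) ≡ lastLetter w
  lastLetter-∷ x (y ∷ w) = refl

  head-occurs : ∀ {p} (w : Word (suc p) n) → Occurs w (head w)
  head-occurs (x ∷ w) = zero , refl

  occurs-∷⁺ : ∀ {ℓ x} {w : Word ℓ n} {a} → Occurs w a → Occurs (x ∷ w) a
  occurs-∷⁺ (i , wᵢ≡a) = suc i , wᵢ≡a

  occurs-∷⁻ : ∀ {ℓ x} {w : Word ℓ n} {a} → Occurs (x ∷ w) a → a ≡ x ⊎ Occurs w a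
  occurs-∷⁻ (zero  , x≡a)  = inj₁ (sym x≡a)
  occurs-∷⁻ (suc i , wᵢ≡a) = inj₂ (i , wᵢ≡a)

  edge-∷⁺ : ∀ {ℓ x} {w : Word ℓ n} {u v} → Edge w u v → Edge (x ∷ w) u v
  edge-∷⁺ (i , j , j≡i+1 , wᵢ≡u , wⱼ≡v , u≢v) = suc i , suc j , cong suc j≡i+1 , wᵢ≡u , wⱼ≡v , u≢v

  edge-∷⁻ : ∀ {p x} {w : Word (suc p) n} {u v} → Edge (x ∷ w) u v → Edge w u v ⊎ (u ≡ x × v ≡ head w)
  edge-∷⁻ {w = y ∷ w} (zero  , suc zero , _ , x≡u , y≡v , _)      = inj₂ (sym x≡u , sym y≡v)
  edge-∷⁻ {w = y ∷ w} (suc i , suc j , j≡i+1 , wᵢ≡u , wⱼ≡v , u≢v) = inj₁ (i , j , suc-injective j≡i+1 , wᵢ≡u , wⱼ≡v , u≢v)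
  edge-∷⁻ {w = y ∷ w} (zero  , zero , () , _)
  edge-∷⁻ {w = y ∷ w} (zero  , suc (suc j) , () , _)
  edge-∷⁻ {w = y ∷ w} (suc i , zero , () , _)

  edge-target-occurs : ∀ {ℓ} {w : Word ℓ n} {u v} → Edge w u v → Occurs w v
  edge-target-occurs (_ , j , _ , _ , wⱼ≡v , _) = j , wⱼ≡v

  no-edge-[_] : ∀ (z : Fin n) {u v} → ¬ Edge (z ∷ []) u v
  no-edge-[ z ] (zero , zero , () , _)

  star-∷⁺ : ∀ {ℓ x} {w : Word ℓ n} {a b} → Star (Edge w) a b → Star (Edge (x ∷ w)) a b
  star-∷⁺ ε        = ε
  star-∷⁺ (e ◅ es) = edge-∷⁺ e ◅ star-∷⁺ es

  reaches-head : ∀ {p} x (w : Word (suc p) n) → Star (Edge (x ∷ w)) x (head w)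
  reaches-head x w with x ≟ᶠ head w
  ... | yes refl = ε
  ... | no x≢hd   = edge-to-head w x≢hd ◅ ε
    where
    edge-to-head : ∀ {p} (w : Word (suc p) n) → x ≢ head w → Edge (x ∷ w) x (head w)
    edge-to-head (y ∷ w) x≢y = zero , suc zero , refl , refl , refl , x≢y

  head-reaches : ∀ {p} (w : Word (suc p) n) y → Occurs w y → Star (Edge w) (head w) y
  head-reaches (z ∷ [])     y (zero , refl) = ε
  head-reaches (x ∷ x′ ∷ w) y y∈w with occurs-∷⁻ y∈w
  ... | inj₁ refl = ε
  ... | inj₂ y∈w′ = reaches-head x (x′ ∷ w) ◅◅ star-∷⁺ (head-reaches (x′ ∷ w) y y∈w′)

  reaches-last : ∀ {p} (w : Word (suc p) n) y → Occurs w y → Star (Edge w) y (lastLetter w)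
  reaches-last (z ∷ [])     y (zero , refl) = ε
  reaches-last (x ∷ x′ ∷ w) y y∈w with occurs-∷⁻ y∈w
  ... | inj₁ refl = reaches-head x (x′ ∷ w) ◅◅ star-∷⁺ (reaches-last (x′ ∷ w) x′ (head-occurs (x′ ∷ w)))
  ... | inj₂ y∈w′ = star-∷⁺ (reaches-last (x′ ∷ w) y y∈w′)

-- Scanning a word from the right

data Label : Set where
  reached pending unseen : Label

promote : Label → Label
promote pending = reached
promote l       = l

reached≢unseen : reached ≢ unseen
reached≢unseen ()

pending≢unseen : pending ≢ unseen
pending≢unseen ()

pending≢reached : pending ≢ reached
pending≢reached ()

promote-unseen : ∀ {l} → promote l ≡ unseen → l ≡ unseen
promote-unseen {unseen} _ = refl

promote-seen : ∀ {l} → l ≢ unseen → promote l ≡ reached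
promote-seen {reached} _ = refl
promote-seen {pending} _ = refl
promote-seen {unseen}  l≢unseen = ⊥-elim (l≢unseen refl)

State : ℕ → Set
State n = Fin n → Label

module _ {n : ℕ} where

  initial : Fin n → State n
  initial z = updateAt (λ _ → unseen) z (λ _ → reached)

  scanLetter : Label → Fin n → State n → State n
  scanLetter reached x s = promote ∘ s
  scanLetter pending x s = s
  scanLetter unseen  x s = updateAt s x (λ _ → pending)

  step : Fin n → State n → State n
  step x s = scanLetter (s x) x s

  scan : ∀ {p} → Word (suc p) n → State n
  scan (z ∷ [])    = initial z
  scan (x ∷ y ∷ w) = step x (scan (y ∷ w))

  scan-∷ : ∀ {p} x (w : Word (suc p) n) → scan (x ∷ w) ≡ step x (scan w)
  scan-∷ x (y ∷ w) = refl

  record ScanInvariant {p} (w : Word (suc p) n) (s : State n) : Set where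
    field
      seen⇒occurs       : ∀ y → s y ≢ unseen → Occurs w y
      occurs⇒seen       : ∀ y → Occurs w y → s y ≢ unseen
      reached⇒reachable : ∀ y → s y ≡ reached → Star (Edge w) (lastLetter w) y
      reached-closed    : ∀ u v → s u ≡ reached → Edge w u v → s v ≡ reached
      last-reached      : s (lastLetter w) ≡ reached

  initial-invariant : ∀ z → ScanInvariant (z ∷ []) (initial z)
  initial-invariant z = record
    { seen⇒occurs       = seen⇒occurs
    ; occurs⇒seen       = λ { y (zero , refl) z≡unseen → reached≢unseen (trans (sym z-reached) z≡unseen) }
    ; reached⇒reachable = reached⇒reachable
    ; reached-closed    = λ _ _ _ e → ⊥-elim (no-edge-[ z ] e)
    ; last-reached      = z-reached
    }
    where
    z-reached : initial z z ≡ reached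
    z-reached = updateAt-updates z (λ _ → unseen)
    others-unseen : ∀ y → y ≢ z → initial z y ≡ unseen
    others-unseen y y≢z = updateAt-minimal y z (λ _ → unseen) y≢z
    seen⇒occurs : ∀ y → initial z y ≢ unseen → Occurs (z ∷ []) y
    seen⇒occurs y y-seen with y ≟ᶠ z
    ... | yes refl = zero , refl
    ... | no y≢z   = ⊥-elim (y-seen (others-unseen y y≢z))
    reached⇒reachable : ∀ y → initial z y ≡ reached → Star (Edge (z ∷ [])) z y
    reached⇒reachable y y-reached with y ≟ᶠ z
    ... | yes refl = ε
    ... | no y≢z   = ⊥-elim (reached≢unseen (trans (sym y-reached) (others-unseen y y≢z)))

  module _ {p} (x : Fin n) (w : Word (suc p) n) (s : State n) (I : ScanInvariant w s) where
    open ScanInvariant I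

    private
      from-last : ∀ {y} → Star (Edge w) (lastLetter w) y → Star (Edge (x ∷ w)) (lastLetter (x ∷ w)) y
      from-last path rewrite lastLetter-∷ x w = star-∷⁺ path

      last-unchanged : ∀ (s′ : State n) → s′ (lastLetter w) ≡ reached → s′ (lastLetter (x ∷ w)) ≡ reached
      last-unchanged s′ e rewrite lastLetter-∷ x w = e

    reached-letter-invariant : s x ≡ reached → ScanInvariant (x ∷ w) (promote ∘ s)
    reached-letter-invariant x-reached = record
      { seen⇒occurs       = λ y y-seen → occurs-∷⁺ (seen⇒occurs y (y-seen ∘ cong promote))
      ; occurs⇒seen       = occurs⇒seen′
      ; reached⇒reachable = λ y y-reached →
          from-last (reached⇒reachable x x-reached) ◅◅ reaches-head x w
            ◅◅ star-∷⁺ (head-reaches w y (seen⇒occurs y (reached≢unseen ∘ trans (sym y-reached) ∘ cong promote)))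
      ; reached-closed    = reached-closed′
      ; last-reached      = last-unchanged (promote ∘ s) (cong promote last-reached)
      }
      where
      occurs⇒seen′ : ∀ y → Occurs (x ∷ w) y → promote (s y) ≢ unseen
      occurs⇒seen′ y y∈xw y-unseen with occurs-∷⁻ y∈xw
      ... | inj₁ refl = reached≢unseen (trans (sym x-reached) (promote-unseen y-unseen))
      ... | inj₂ y∈w  = occurs⇒seen y y∈w (promote-unseen y-unseen)
      reached-closed′ : ∀ u v → promote (s u) ≡ reached → Edge (x ∷ w) u v → promote (s v) ≡ reached
      reached-closed′ u v _ e with occurs-∷⁻ {x = x} {w = w} (edge-target-occurs {w = x ∷ w} e)
      ... | inj₁ refl = cong promote x-reached
      ... | inj₂ v∈w  = promote-seen (occurs⇒seen v v∈w)

    pending-letter-invariant : s x ≡ pending → ScanInvariant (x ∷ w) s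
    pending-letter-invariant x-pending = record
      { seen⇒occurs       = λ y y-seen → occurs-∷⁺ (seen⇒occurs y y-seen)
      ; occurs⇒seen       = occurs⇒seen′
      ; reached⇒reachable = λ y y-reached → from-last (reached⇒reachable y y-reached)
      ; reached-closed    = reached-closed′
      ; last-reached      = last-unchanged s last-reached
      }
      where
      occurs⇒seen′ : ∀ y → Occurs (x ∷ w) y → s y ≢ unseen
      occurs⇒seen′ y y∈xw y-unseen with occurs-∷⁻ y∈xw
      ... | inj₁ refl = pending≢unseen (trans (sym x-pending) y-unseen)
      ... | inj₂ y∈w  = occurs⇒seen y y∈w y-unseen
      reached-closed′ : ∀ u v → s u ≡ reached → Edge (x ∷ w) u v → s v ≡ reached
      reached-closed′ u v u-reached e with edge-∷⁻ e
      ... | inj₁ e′         = reached-closed u v u-reached e′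
      ... | inj₂ (refl , _) = ⊥-elim (pending≢reached (trans (sym x-pending) u-reached))

    unseen-letter-invariant : s x ≡ unseen → ScanInvariant (x ∷ w) (updateAt s x (λ _ → pending))
    unseen-letter-invariant x-unseen = record
      { seen⇒occurs       = seen⇒occurs′
      ; occurs⇒seen       = occurs⇒seen′
      ; reached⇒reachable = reached⇒reachable′
      ; reached-closed    = reached-closed′
      ; last-reached      = last-reached′
      }
      where
      s′ = updateAt s x (λ _ → pending)
      x-pending : s′ x ≡ pending
      x-pending = updateAt-updates x s
      unchanged : ∀ {y} → y ≢ x → s′ y ≡ s y
      unchanged {y} y≢x = updateAt-minimal y x s y≢x
      seen⇒occurs′ : ∀ y → s′ y ≢ unseen → Occurs (x ∷ w) y
      seen⇒occurs′ y y-seen with y ≟ᶠ x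
      ... | yes refl = zero , refl
      ... | no y≢x   = occurs-∷⁺ (seen⇒occurs y (y-seen ∘ trans (unchanged y≢x)))
      occurs⇒seen′ : ∀ y → Occurs (x ∷ w) y → s′ y ≢ unseen
      occurs⇒seen′ y y∈xw y-unseen with y ≟ᶠ x | occurs-∷⁻ y∈xw
      ... | yes refl | _         = pending≢unseen (trans (sym x-pending) y-unseen)
      ... | no y≢x   | inj₁ y≡x  = y≢x y≡x
      ... | no y≢x   | inj₂ y∈w  = occurs⇒seen y y∈w (trans (sym (unchanged y≢x)) y-unseen)
      reached⇒reachable′ : ∀ y → s′ y ≡ reached → Star (Edge (x ∷ w)) (lastLetter (x ∷ w)) y
      reached⇒reachable′ y y-reached with y ≟ᶠ x
      ... | yes refl = ⊥-elim (pending≢reached (trans (sym x-pending) y-reached))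
      ... | no y≢x   = from-last (reached⇒reachable y (trans (sym (unchanged y≢x)) y-reached))
      reached-closed′ : ∀ u v → s′ u ≡ reached → Edge (x ∷ w) u v → s′ v ≡ reached
      reached-closed′ u v u-reached e with u ≟ᶠ x
      ... | yes refl = ⊥-elim (pending≢reached (trans (sym x-pending) u-reached))
      ... | no u≢x with edge-∷⁻ e
      ...   | inj₂ (u≡x , _) = ⊥-elim (u≢x u≡x)
      ...   | inj₁ e′ with reached-closed u v (trans (sym (unchanged u≢x)) u-reached) e′ | v ≟ᶠ x
      ...     | v-reached | yes refl = ⊥-elim (reached≢unseen (trans (sym v-reached) x-unseen))
      ...     | v-reached | no v≢x   = trans (unchanged v≢x) v-reached
      last-reached′ : s′ (lastLetter (x ∷ w)) ≡ reached
      last-reached′ with lastLetter w ≟ᶠ x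
      ... | yes last≡x = ⊥-elim (reached≢unseen (trans (sym last-reached) (trans (cong s last≡x) x-unseen)))
      ... | no last≢x  = last-unchanged s′ (trans (unchanged last≢x) last-reached)

    scanLetter-invariant : ∀ l → s x ≡ l → ScanInvariant (x ∷ w) (scanLetter l x s)
    scanLetter-invariant reached = reached-letter-invariant
    scanLetter-invariant pending = pending-letter-invariant
    scanLetter-invariant unseen  = unseen-letter-invariant

  scan-invariant : ∀ {p} (w : Word (suc p) n) → ScanInvariant w (scan w)
  scan-invariant (z ∷ [])    = initial-invariant z
  scan-invariant (x ∷ y ∷ w) = scanLetter-invariant x (y ∷ w) (scan (y ∷ w)) (scan-invariant (y ∷ w)) _ refl

  all-reached⇔connected : ∀ {p} (w : Word (suc p) n) →
    (∀ y → scan w y ≡ reached) ⇔ (UsesAll w × StronglyConnected w)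
  all-reached⇔connected w = mk⇔ to from
    where
    open ScanInvariant (scan-invariant w)
    occurs : (∀ y → scan w y ≡ reached) → UsesAll w
    occurs all-reached y = seen⇒occurs y (reached≢unseen ∘ trans (sym (all-reached y)))
    to : (∀ y → scan w y ≡ reached) → UsesAll w × StronglyConnected w
    to all-reached = occurs all-reached ,
      λ u v → reaches-last w u (occurs all-reached u) ◅◅ reached⇒reachable v (all-reached v)
    reached-along : ∀ {u v} → scan w u ≡ reached → Star (Edge w) u v → scan w v ≡ reached
    reached-along u-reached ε        = u-reached
    reached-along u-reached (e ◅ es) = reached-along (reached-closed _ _ u-reached e) es
    from : UsesAll w × StronglyConnected w → ∀ y → scan w y ≡ reached
    from (uses-all , connected) y with scan w y in y-label
    ... | reached = refl
    ... | pending = ⊥-elim (pending≢reached (trans (sym y-label) (reached-along last-reached (connected (lastLetter w) y))))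
    ... | unseen  = ⊥-elim (occurs⇒seen y (uses-all y) y-label)

δᴸ : Label → Label → ℕ
δᴸ reached reached = 1
δᴸ pending pending = 1
δᴸ unseen  unseen  = 1
δᴸ _       _       = 0

label-decomposition : ∀ (g : Label → ℕ) l →
  g l ≡ δᴸ l reached * g reached + δᴸ l pending * g pending + δᴸ l unseen * g unseen
label-decomposition g reached = sym (trans (+-identityʳ _) (trans (+-identityʳ _) (+-identityʳ _)))
label-decomposition g pending = sym (trans (+-identityʳ _) (+-identityʳ _))
label-decomposition g unseen  = sym (+-identityʳ _)

module _ {n : ℕ} where

  count : Label → State n → ℕ
  count l s = ∑[ y < n ] δᴸ (s y) l

  #seen : State n → ℕ
  #seen s = count reached s + count pending s

  ∑-by-label : ∀ (s : State n) (g : Label → ℕ) →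
    ∑[ y < n ] g (s y) ≡ count reached s * g reached + count pending s * g pending + count unseen s * g unseen
  ∑-by-label s g = begin
    ∑[ y < n ] g (s y)
      ≡⟨ sum-cong-≗ (λ y → label-decomposition g (s y)) ⟩
    ∑[ y < n ] (part reached y + part pending y + part unseen y)
      ≡⟨ ∑-distrib-+ (λ y → part reached y + part pending y) (part unseen) ⟩
    ∑[ y < n ] (part reached y + part pending y) + ∑[ y < n ] part unseen y
      ≡⟨ cong (_+ ∑[ y < n ] part unseen y) (∑-distrib-+ (part reached) (part pending)) ⟩
    ∑[ y < n ] part reached y + ∑[ y < n ] part pending y + ∑[ y < n ] part unseen y
      ≡⟨ sym (cong₂ _+_ (cong₂ _+_ (by-count reached) (by-count pending)) (by-count unseen)) ⟩
    count reached s * g reached + count pending s * g pending + count unseen s * g unseen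
      ∎
    where
    open ≡-Reasoning
    part : Label → Fin n → ℕ
    part l y = δᴸ (s y) l * g l
    by-count : ∀ l → count l s * g l ≡ ∑[ y < n ] part l y
    by-count l = *-distribʳ-sum (g l) (λ y → δᴸ (s y) l)

  count-unseen : ∀ s → count unseen s ≡ n ∸ #seen s
  count-unseen s = sym (trans (cong (_∸ #seen s) (sym labels-partition)) (m+n∸m≡n (#seen s) (count unseen s)))
    where
    labels-partition : #seen s + count unseen s ≡ n
    labels-partition = begin
      count reached s + count pending s + count unseen s
        ≡⟨ sym (cong₂ _+_ (cong₂ _+_ (*-identityʳ (count reached s)) (*-identityʳ (count pending s))) (*-identityʳ (count unseen s))) ⟩
      count reached s * 1 + count pending s * 1 + count unseen s * 1
        ≡⟨ sym (∑-by-label s (λ _ → 1)) ⟩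
      ∑[ y < n ] 1
        ≡⟨ trans (∑-const n 1) (*-identityʳ n) ⟩
      n ∎
      where open ≡-Reasoning

  private
    count-marked : ∀ s x l → count l (updateAt s x (λ _ → pending)) + δᴸ (s x) l ≡ count l s + δᴸ pending l
    count-marked s x l = ∑-updateAt s x (λ _ → pending) (λ a → δᴸ a l)

  initial-stats : ∀ z → #seen (initial z) ≡ 1 × count pending (initial z) ≡ 0
  initial-stats z = cong₂ _+_ reached-once pending-none , pending-none
    where
    all-unseen : ∀ l → δᴸ unseen l ≡ 0 → count l (λ _ → unseen) ≡ 0
    all-unseen l unseen≢l = trans (sum-cong-≗ {n} (λ _ → unseen≢l)) (sum-replicate-zero n)
    reached-once : count reached (initial z) ≡ 1
    reached-once = trans (sym (+-identityʳ _))
      (trans (∑-updateAt (λ _ → unseen) z (λ _ → reached) (λ a → δᴸ a reached)) (cong (_+ 1) (all-unseen reached refl)))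
    pending-none : count pending (initial z) ≡ 0
    pending-none = trans (sym (+-identityʳ _))
      (trans (∑-updateAt (λ _ → unseen) z (λ _ → reached) (λ a → δᴸ a pending)) (trans (+-identityʳ _) (all-unseen pending refl)))

  afterLetter : (ℕ → ℕ → ℕ) → State n → Label → ℕ
  afterLetter φ s reached = φ (#seen s) 0
  afterLetter φ s pending = φ (#seen s) (count pending s)
  afterLetter φ s unseen  = φ (suc (#seen s)) (suc (count pending s))

  scanLetter-stats : ∀ (φ : ℕ → ℕ → ℕ) s x l → s x ≡ l →
    φ (#seen (scanLetter l x s)) (count pending (scanLetter l x s)) ≡ afterLetter φ s l
  scanLetter-stats φ s x reached _ = cong₂ φ (trans (cong₂ _+_ promoted-reached promoted-pending) (+-identityʳ (#seen s))) promoted-pending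
    where
    promoted-reached : count reached (promote ∘ s) ≡ #seen s
    promoted-reached = trans (sum-cong-≗ (λ y → promote-to-reached (s y))) (∑-distrib-+ (λ y → δᴸ (s y) reached) (λ y → δᴸ (s y) pending))
      where
      promote-to-reached : ∀ l → δᴸ (promote l) reached ≡ δᴸ l reached + δᴸ l pending
      promote-to-reached reached = refl
      promote-to-reached pending = refl
      promote-to-reached unseen  = refl
    promoted-pending : count pending (promote ∘ s) ≡ 0
    promoted-pending = trans (sum-cong-≗ (λ y → promote-not-pending (s y))) (sum-replicate-zero n)
      where
      promote-not-pending : ∀ l → δᴸ (promote l) pending ≡ 0
      promote-not-pending reached = refl
      promote-not-pending pending = refl
      promote-not-pending unseen  = refl
  scanLetter-stats φ s x pending _        = refl
  scanLetter-stats φ s x unseen  x-unseen = cong₂ φ (trans (cong₂ _+_ marked-reached marked-pending) (+-suc _ _)) marked-pending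
    where
    marked-reached : count reached (updateAt s x (λ _ → pending)) ≡ count reached s
    marked-reached = trans (sym (+-identityʳ _)) (trans (cong (λ l → count reached (updateAt s x (λ _ → pending)) + δᴸ l reached) (sym x-unseen))
                       (trans (count-marked s x reached) (+-identityʳ _)))
    marked-pending : count pending (updateAt s x (λ _ → pending)) ≡ suc (count pending s)
    marked-pending = trans (sym (+-identityʳ _)) (trans (cong (λ l → count pending (updateAt s x (λ _ → pending)) + δᴸ l pending) (sym x-unseen))
                       (trans (count-marked s x pending) (+-comm _ 1)))

  ∑-step : ∀ s (φ : ℕ → ℕ → ℕ) →
    ∑[ x < n ] φ (#seen (step x s)) (count pending (step x s))
      ≡ count reached s * φ (#seen s) 0 + count pending s * φ (#seen s) (count pending s)
        + (n ∸ #seen s) * φ (suc (#seen s)) (suc (count pending s))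
  ∑-step s φ = begin
    ∑[ x < n ] φ (#seen (step x s)) (count pending (step x s))
      ≡⟨ sum-cong-≗ (λ x → scanLetter-stats φ s x (s x) refl) ⟩
    ∑[ x < n ] afterLetter φ s (s x)
      ≡⟨ ∑-by-label s (afterLetter φ s) ⟩
    count reached s * afterLetter φ s reached + count pending s * afterLetter φ s pending + count unseen s * afterLetter φ s unseen
      ≡⟨ cong (λ k → count reached s * afterLetter φ s reached + count pending s * afterLetter φ s pending + k * afterLetter φ s unseen)
              (count-unseen s) ⟩
    count reached s * afterLetter φ s reached + count pending s * afterLetter φ s pending + (n ∸ #seen s) * afterLetter φ s unseen
      ∎
    where open ≡-Reasoning

module _ {n : ℕ} where

  full-stats⇔all-reached : ∀ (s : State n) → δ (#seen s) n * δ (count pending s) 0 ≡ 1 ⇔ (∀ y → s y ≡ reached)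
  full-stats⇔all-reached s = mk⇔ to from
    where
    to : δ (#seen s) n * δ (count pending s) 0 ≡ 1 → ∀ y → s y ≡ reached
    to full y = δᴸ≡1 (s y) (∑-≤1-full (λ y → δᴸ (s y) reached) (λ y → δᴸ≤1 (s y)) count-reached≡n y)
      where
      seen≡n    = δ≡1⇒≡ (m*n≡1⇒m≡1 _ _ full)
      pending≡0 = δ≡1⇒≡ (m*n≡1⇒n≡1 (δ (#seen s) n) _ full)
      count-reached≡n : count reached s ≡ n
      count-reached≡n = trans (sym (+-identityʳ _)) (trans (cong (count reached s +_) (sym pending≡0)) seen≡n)
      δᴸ≤1 : ∀ l → δᴸ l reached ≤ 1
      δᴸ≤1 reached = ≤-refl
      δᴸ≤1 pending = z≤n
      δᴸ≤1 unseen  = z≤n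
      δᴸ≡1 : ∀ l → δᴸ l reached ≡ 1 → l ≡ reached
      δᴸ≡1 reached _ = refl
    from : (∀ y → s y ≡ reached) → δ (#seen s) n * δ (count pending s) 0 ≡ 1
    from all-reached = begin
      δ (count reached s + count pending s) n * δ (count pending s) 0
        ≡⟨ cong₂ (λ a b → δ (a + b) n * δ b 0) reached≡n pending≡0 ⟩
      δ (n + 0) n * 1
        ≡⟨ trans (*-identityʳ _) (cong (λ a → δ a n) (+-identityʳ n)) ⟩
      δ n n
        ≡⟨ δ-refl n ⟩
      1 ∎
      where
      open ≡-Reasoning
      reached≡n : count reached s ≡ n
      reached≡n = trans (sum-cong-≗ (λ y → cong (λ l → δᴸ l reached) (all-reached y))) (trans (∑-const n 1) (*-identityʳ n))
      pending≡0 : count pending s ≡ 0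
      pending≡0 = trans (sum-cong-≗ (λ y → cong (λ l → δᴸ l pending) (all-reached y))) (sum-replicate-zero n)

-- Counting words by their scan statistics

-- Scanning one more letter moves the statistics (r + q, q) of a state with r reached and
-- q pending letters to (r + q, 0) for r choices of the letter, keeps them for q choices,
-- and moves them to (r + q + 1, q + 1) for the n ∸ (r + q) unseen ones.
δ-into-settled : ∀ r q t m →
  r * (δ (r + q) t * 1) + q * (δ (r + q) t * δ q 0) + m * (δ (suc (r + q)) t * 0)
    ≡ ∑ℕ (suc t) (λ c → δ (r + q) t * δ q c * (t ∸ c))
δ-into-settled r q t m with r + q ≟ t
... | no r+q≢t rewrite δ-≢ r+q≢t | *-zeroʳ r | *-zeroʳ q | *-zeroʳ (δ (suc (r + q)) t) | *-zeroʳ m =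
  sym (∑ℕ-zero (suc t) (λ _ _ → refl))
... | yes refl rewrite δ-refl (r + q) = begin
  r * (1 * 1) + q * (1 * δ q 0) + m * (δ (suc (r + q)) (r + q) * 0)
    ≡⟨ simplify r q (δ q 0) m (δ (suc (r + q)) (r + q)) ⟩
  r + q * δ q 0
    ≡⟨ cong (r +_) (q*δq0≡0 q) ⟩
  r + 0
    ≡⟨ +-identityʳ r ⟩
  r
    ≡⟨ sym (m+n∸n≡m r q) ⟩
  r + q ∸ q
    ≡⟨ sym (∑ℕ-δ (suc (r + q)) q (r + q ∸_) (s≤s (m≤n+m q r))) ⟩
  ∑ℕ (suc (r + q)) (λ c → δ q c * (r + q ∸ c))
    ≡⟨ ∑ℕ-cong (suc (r + q)) (λ c _ → cong (_* (r + q ∸ c)) (sym (*-identityˡ (δ q c)))) ⟩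
  ∑ℕ (suc (r + q)) (λ c → 1 * δ q c * (r + q ∸ c))
    ∎
  where
  open ≡-Reasoning
  simplify : ∀ r q z m y → r * (1 * 1) + q * (1 * z) + m * (y * 0) ≡ r + q * z
  simplify = solve-∀
  q*δq0≡0 : ∀ q → q * δ q 0 ≡ 0
  q*δq0≡0 zero    = refl
  q*δq0≡0 (suc q) = *-zeroʳ (suc q)

δ-into-no-letters : ∀ r q c m →
  r * (δ (r + q) 0 * 0) + q * (δ (r + q) 0 * δ q (suc c)) + m * 0 ≡ 0
δ-into-no-letters r q c m rewrite *-zeroʳ (δ (r + q) 0) | *-zeroʳ r | *-zeroʳ m = trans (+-identityʳ _) (pending⇒letters q)
  where
  pending⇒letters : ∀ q → q * (δ (r + q) 0 * δ q (suc c)) ≡ 0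
  pending⇒letters zero    = refl
  pending⇒letters (suc q) rewrite +-suc r q = *-zeroʳ (suc q)

δ-into-pending : ∀ r q n t c →
  r * (δ (r + q) (suc t) * 0) + q * (δ (r + q) (suc t) * δ q (suc c)) + (n ∸ (r + q)) * (δ (r + q) t * δ q c)
    ≡ δ (r + q) (suc t) * δ q (suc c) * suc c + δ (r + q) t * δ q c * (n ∸ t)
δ-into-pending r q n t c = begin
  r * (x * 0) + q * (x * d) + (n ∸ (r + q)) * (y * e)  ≡⟨ regroup r q (n ∸ (r + q)) x d y e ⟩
  x * (d * q) + e * (y * (n ∸ (r + q)))                ≡⟨ cong₂ (λ u v → x * u + e * v) (δ-subst q (suc c) id) (δ-subst (r + q) t (n ∸_)) ⟩
  x * (d * suc c) + e * (y * (n ∸ t))                  ≡⟨ reassociate x d (suc c) e y (n ∸ t) ⟩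
  x * d * suc c + y * e * (n ∸ t)                      ∎
  where
  open ≡-Reasoning
  x = δ (r + q) (suc t)
  d = δ q (suc c)
  y = δ (r + q) t
  e = δ q c
  regroup : ∀ r q m x d y e → r * (x * 0) + q * (x * d) + m * (y * e) ≡ x * (d * q) + e * (y * m)
  regroup = solve-∀
  reassociate : ∀ x d s e y m → x * (d * s) + e * (y * m) ≡ x * d * s + y * e * m
  reassociate = solve-∀

module _ (n : ℕ) where

  words : ∀ ℓ → List (Word ℓ n)
  words zero    = [] ∷ []
  words (suc ℓ) = cartesianProductWith _∷_ (allFin n) (words ℓ)

  words-unique : ∀ ℓ → Unique (words ℓ)
  words-unique zero    = [] ∷ []
  words-unique (suc ℓ) = Unique.cartesianProductWith⁺ _∷_ ∷-injective (Unique.allFin⁺ n) (words-unique ℓ)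

  ∈-words : ∀ {ℓ} (w : Word ℓ n) → w ∈ words ℓ
  ∈-words []      = here refl
  ∈-words (x ∷ w) = ∈-cartesianProductWith⁺ _∷_ (∈-allFin x) (∈-words w)

  ∑-words-∷ : ∀ ℓ (f : Word (suc ℓ) n → ℕ) → ∑ˡ (words (suc ℓ)) f ≡ ∑ˡ (words ℓ) (λ w → ∑[ x < n ] f (x ∷ w))
  ∑-words-∷ ℓ f = begin
    ∑ˡ (words (suc ℓ)) f                               ≡⟨ ∑ˡ-cartesianProductWith _∷_ (allFin n) (words ℓ) f ⟩
    ∑ˡ (allFin n) (λ x → ∑ˡ (words ℓ) (λ w → f (x ∷ w))) ≡⟨ ∑ˡ-tabulate id (λ x → ∑ˡ (words ℓ) (λ w → f (x ∷ w))) ⟩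
    ∑[ x < n ] ∑ˡ (words ℓ) (λ w → f (x ∷ w))          ≡⟨ sym (∑ˡ-∑-comm (words ℓ) (λ x w → f (x ∷ w))) ⟩
    ∑ˡ (words ℓ) (λ w → ∑[ x < n ] f (x ∷ w))          ∎
    where open ≡-Reasoning

  hasStats : ∀ {p} → ℕ → ℕ → Word (suc p) n → ℕ
  hasStats t c w = δ (#seen (scan w)) t * δ (count pending (scan w)) c

  #words : ℕ → ℕ → ℕ → ℕ
  #words p t c = ∑ˡ (words (suc p)) (hasStats t c)

  ∑-words-scan : ∀ p (φ : ℕ → ℕ → ℕ) →
    ∑ˡ (words (suc (suc p))) (λ w → φ (#seen (scan w)) (count pending (scan w)))
      ≡ ∑ˡ (words (suc p)) (λ w → let s = scan w in
          count reached s * φ (#seen s) 0 + count pending s * φ (#seen s) (count pending s)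
          + (n ∸ #seen s) * φ (suc (#seen s)) (suc (count pending s)))
  ∑-words-scan p φ = trans (∑-words-∷ (suc p) _) (∑ˡ-cong (words (suc p)) λ w →
    trans (sum-cong-≗ (λ x → cong (λ s → φ (#seen s) (count pending s)) (scan-∷ x w))) (∑-step (scan w) φ))

  #words-initial : ∀ t c → #words 0 t c ≡ n * (δ 1 t * δ 0 c)
  #words-initial t c = begin
    #words 0 t c
      ≡⟨ trans (∑-words-∷ 0 _) (+-identityʳ _) ⟩
    ∑[ z < n ] (δ (#seen (initial z)) t * δ (count pending (initial z)) c)
      ≡⟨ sum-cong-≗ {n} (λ z → let seen≡1 , pending≡0 = initial-stats z in cong₂ (λ a b → δ a t * δ b c) seen≡1 pending≡0) ⟩
    ∑[ z < n ] (δ 1 t * δ 0 c)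
      ≡⟨ ∑-const n (δ 1 t * δ 0 c) ⟩
    n * (δ 1 t * δ 0 c)
      ∎
    where open ≡-Reasoning

  #words-settled : ∀ p t → #words (suc p) t 0 ≡ ∑ℕ (suc t) (λ c → #words p t c * (t ∸ c))
  #words-settled p t = begin
    #words (suc p) t 0
      ≡⟨ ∑-words-scan p (λ a b → δ a t * δ b 0) ⟩
    ∑ˡ (words (suc p)) (λ w → let s = scan w in
      count reached s * (δ (#seen s) t * 1) + count pending s * (δ (#seen s) t * δ (count pending s) 0)
      + (n ∸ #seen s) * (δ (suc (#seen s)) t * 0))
      ≡⟨ ∑ˡ-cong (words (suc p)) (λ w → δ-into-settled (count reached (scan w)) (count pending (scan w)) t (n ∸ #seen (scan w))) ⟩
    ∑ˡ (words (suc p)) (λ w → ∑ℕ (suc t) (λ c → hasStats t c w * (t ∸ c)))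
      ≡⟨ ∑ˡ-∑ℕ-comm (words (suc p)) (suc t) (λ c w → hasStats t c w * (t ∸ c)) ⟩
    ∑ℕ (suc t) (λ c → ∑ˡ (words (suc p)) (λ w → hasStats t c w * (t ∸ c)))
      ≡⟨ ∑ℕ-cong (suc t) (λ c _ → ∑ˡ-*ʳ (words (suc p)) (hasStats t c) (t ∸ c)) ⟩
    ∑ℕ (suc t) (λ c → #words p t c * (t ∸ c))
      ∎
    where open ≡-Reasoning

  #words-no-letters : ∀ p c → #words (suc p) 0 (suc c) ≡ 0
  #words-no-letters p c = begin
    #words (suc p) 0 (suc c)
      ≡⟨ ∑-words-scan p (λ a b → δ a 0 * δ b (suc c)) ⟩
    ∑ˡ (words (suc p)) (λ w → let s = scan w in
      count reached s * (δ (#seen s) 0 * 0) + count pending s * (δ (#seen s) 0 * δ (count pending s) (suc c))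
      + (n ∸ #seen s) * 0)
      ≡⟨ ∑ˡ-cong (words (suc p)) (λ w → δ-into-no-letters (count reached (scan w)) (count pending (scan w)) c (n ∸ #seen (scan w))) ⟩
    ∑ˡ (words (suc p)) (λ _ → 0)
      ≡⟨ ∑ˡ-zero (words (suc p)) ⟩
    0 ∎
    where open ≡-Reasoning

  #words-pending : ∀ p t c → #words (suc p) (suc t) (suc c) ≡ #words p (suc t) (suc c) * suc c + #words p t c * (n ∸ t)
  #words-pending p t c = begin
    #words (suc p) (suc t) (suc c)
      ≡⟨ ∑-words-scan p (λ a b → δ a (suc t) * δ b (suc c)) ⟩
    ∑ˡ (words (suc p)) (λ w → let s = scan w in
      count reached s * (δ (#seen s) (suc t) * 0) + count pending s * (δ (#seen s) (suc t) * δ (count pending s) (suc c))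
      + (n ∸ #seen s) * (δ (#seen s) t * δ (count pending s) c))
      ≡⟨ ∑ˡ-cong (words (suc p)) (λ w → δ-into-pending (count reached (scan w)) (count pending (scan w)) n t c) ⟩
    ∑ˡ (words (suc p)) (λ w → hasStats (suc t) (suc c) w * suc c + hasStats t c w * (n ∸ t))
      ≡⟨ ∑ˡ-distrib-+ (words (suc p)) (λ w → hasStats (suc t) (suc c) w * suc c) (λ w → hasStats t c w * (n ∸ t)) ⟩
    ∑ˡ (words (suc p)) (λ w → hasStats (suc t) (suc c) w * suc c) + ∑ˡ (words (suc p)) (λ w → hasStats t c w * (n ∸ t))
      ≡⟨ cong₂ _+_ (∑ˡ-*ʳ (words (suc p)) (hasStats (suc t) (suc c)) (suc c)) (∑ˡ-*ʳ (words (suc p)) (hasStats t c) (n ∸ t)) ⟩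
    #words p (suc t) (suc c) * suc c + #words p t c * (n ∸ t)
      ∎
    where open ≡-Reasoning

  #words≡P′*E : ∀ p t c → #words p t c ≡ (n P′ t) * E p t c
  #words≡P′*E zero t c = trans (#words-initial t c) (single-letter t c)
    where
    single-letter : ∀ t c → n * (δ 1 t * δ 0 c) ≡ (n P′ t) * E 0 t c
    single-letter zero          c       = *-zeroʳ n
    single-letter (suc zero)    zero    = sym (*-assoc n 1 1)
    single-letter (suc zero)    (suc c) = trans (*-zeroʳ n) (sym (*-zeroʳ (n * 1)))
    single-letter (suc (suc t)) c       = trans (*-zeroʳ n) (sym (*-zeroʳ (n P′ suc (suc t))))
  #words≡P′*E (suc p) t zero = begin
    #words (suc p) t 0
      ≡⟨ #words-settled p t ⟩
    ∑ℕ (suc t) (λ c → #words p t c * (t ∸ c))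
      ≡⟨ ∑ℕ-cong (suc t) (λ c _ → trans (cong (_* (t ∸ c)) (#words≡P′*E p t c)) (*-assoc (n P′ t) _ _)) ⟩
    ∑ℕ (suc t) (λ c → (n P′ t) * (E p t c * (t ∸ c)))
      ≡⟨ ∑ℕ-*ˡ (suc t) (λ c → E p t c * (t ∸ c)) (n P′ t) ⟩
    (n P′ t) * E (suc p) t 0
      ∎
    where open ≡-Reasoning
  #words≡P′*E (suc p) zero    (suc c) = #words-no-letters p c
  #words≡P′*E (suc p) (suc t) (suc c) = begin
    #words (suc p) (suc t) (suc c)
      ≡⟨ #words-pending p t c ⟩
    #words p (suc t) (suc c) * suc c + #words p t c * (n ∸ t)
      ≡⟨ cong₂ (λ a b → a * suc c + b * (n ∸ t)) (#words≡P′*E p (suc t) (suc c)) (#words≡P′*E p t c) ⟩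
    (n ∸ t) * (n P′ t) * E p (suc t) (suc c) * suc c + (n P′ t) * E p t c * (n ∸ t)
      ≡⟨ factor (n ∸ t) (n P′ t) (E p (suc t) (suc c)) (suc c) (E p t c) ⟩
    (n ∸ t) * (n P′ t) * (E p (suc t) (suc c) * suc c + E p t c)
      ∎
    where
    open ≡-Reasoning
    factor : ∀ m P e s f → m * P * e * s + P * f * m ≡ m * P * (e * s + f)
    factor = solve-∀

nP′n≡n! : ∀ n → n P′ n ≡ n !
nP′n≡n! n = trans (cong (λ b → if b then n P′ n else 0) (sym (Equivalence.to T-≡ (≤⇒≤ᵇ (≤-refl {n}))))) (nPn≡n! n)

theorem4 : (ℓ n : ℕ) → 0 < n → n < ℓ →
    ∃ λ (L : List (Word ℓ n)) →
      Unique L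
      × ((ω : Word ℓ n) → (ω ∈ L) ⇔ (UsesAll ω × StronglyConnected ω))
      × length L ≡ n ! * T ℓ n
theorem4 (suc p) n 0<n n<ℓ = L , Unique.filter⁺ full? (words-unique n (suc p)) , membership , size
  where
  full : Word (suc p) n → ℕ
  full = hasStats n n 0
  full≤1 : ∀ w → full w ≤ 1
  full≤1 w = *-mono-≤ (δ≤1 (#seen (scan w)) n) (δ≤1 (count pending (scan w)) 0)
  full? = λ w → full w ≟ 1
  L = filter full? (words n (suc p))
  full⇔connected : ∀ ω → full ω ≡ 1 ⇔ (UsesAll ω × StronglyConnected ω)
  full⇔connected ω = all-reached⇔connected ω ⇔-∘ full-stats⇔all-reached (scan ω)
  membership : ∀ ω → ω ∈ L ⇔ (UsesAll ω × StronglyConnected ω)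
  membership ω = mk⇔ (λ ω∈L → Equivalence.to (full⇔connected ω) (proj₂ (∈-filter⁻ full? {xs = words n (suc p)} ω∈L)))
                     (λ connected → ∈-filter⁺ full? (∈-words n ω) (Equivalence.from (full⇔connected ω) connected))
  size : length L ≡ n ! * T (suc p) n
  size = begin
    length L              ≡⟨ length-filter-indicator (words n (suc p)) full full≤1 ⟩
    #words n p n 0        ≡⟨ #words≡P′*E n p n 0 ⟩
    (n P′ n) * E p n 0    ≡⟨ cong₂ _*_ (nP′n≡n! n) (E≡T p n 0<n n<ℓ) ⟩
    n ! * T (suc p) n     ∎
    where open ≡-Reasoning
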